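{- Let $0<\delta\le1/8$. Consider an instance without release dates in which all machine speeds are integer powers of $1+\delta$ and the maximum speed is $1$, and let $OPT$ be an optimal schedule in which the maximum work of a machine of speed $1$ lies in $[\frac1{1+\delta},1)$. Then no machine has load strictly above $\frac2\delta$ in $OPT$, and $\frac2\delta$ is also an upper bound on the work of every machine in $OPT$.
   Context: Scheduling without release dates on uniformly related machines, minimizing total weighted completion time, with positive job sizes and weights. In a schedule, the work of a machine is the total size of jobs assigned to it, and its load is its completion time, i.e. (for schedules without idle time, such as optimal ones) its work divided by its speed.
   Formalization: The parameter δ, the job sizes and weights, and the machine speeds are rational. -}

module Defs where

open import Data.Nat using (ℕ; zero; suc)
open import Data.Fin using (Fin)
open import Data.List using (List; []; _∷_; allFin; concatMap; map)
open import Data.Product using (Σ; _×_; _,_)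
open import Data.Sum using (_⊎_)
open import Relation.Binary.PropositionalEquality using (_≡_)
open import Data.List.Relation.Binary.Permutation.Propositional using (_↭_)
open import Data.Rational using (ℚ; 0ℚ; 1ℚ; _+_; _*_; _÷_; _≤_; _<_; Positive)
open import Data.Rational.Properties using (pos⇒nonZero; nonNeg+pos⇒pos)

_^ℕ_ : ℚ → ℕ → ℚ
b ^ℕ zero  = 1ℚ
b ^ℕ suc k = b * (b ^ℕ k)

-- s is an integer power of b:  s = b^k  or  s = b^(-k)  (i.e. s * b^k = 1), k ∈ ℕ
IsIntegerPowerOf : ℚ → ℚ → Set
IsIntegerPowerOf b s = Σ ℕ (λ k → s ≡ b ^ℕ k) ⊎ Σ ℕ (λ k → s * (b ^ℕ k) ≡ 1ℚ)

divPos : ℚ → (q : ℚ) → Positive q → ℚ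
divPos p q h = _÷_ p q {{pos⇒nonZero q {{h}}}}

1+pos : (δ : ℚ) → Positive δ → Positive (1ℚ + δ)
1+pos δ h = nonNeg+pos⇒pos 1ℚ δ {{h}}

sumℚ : List ℚ → ℚ
sumℚ []       = 0ℚ
sumℚ (x ∷ xs) = x + sumℚ xs

-- An instance of Q | | Σ w_j C_j (uniformly related machines, no release dates):
-- n jobs with positive sizes and weights, m machines with positive speeds.
record Instance (n m : ℕ) : Set where
  field
    size     : Fin n → ℚ
    weight   : Fin n → ℚ
    speed    : Fin m → ℚ
    size>0   : ∀ j → Positive (size j)
    weight>0 : ∀ j → Positive (weight j)
    speed>0  : ∀ i → Positive (speed i)

-- A (non-idle) schedule: for each machine, the ordered list of jobs it processes
-- (first job first).  Validity: every job appears exactly once overall.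
Schedule : ℕ → ℕ → Set
Schedule n m = Fin m → List (Fin n)

Valid : ∀ {n m} → Schedule n m → Set
Valid {n} {m} S = concatMap S (allFin m) ↭ allFin n

module _ {n m : ℕ} (I : Instance n m) where
  open Instance I

  work : Schedule n m → Fin m → ℚ
  work S i = sumℚ (map size (S i))

  -- load of a machine: completion time = work / speed (no idle time)
  load : Schedule n m → Fin m → ℚ
  load S i = divPos (work S i) (speed i) (speed>0 i)

  -- Σ over the list of w_j * (total size of jobs up to and including j), given
  -- the work already done before the list starts
  weightedPrefix : ℚ → List (Fin n) → ℚ
  weightedPrefix done []       = 0ℚ
  weightedPrefix done (j ∷ js) =
    weight j * (done + size j) + weightedPrefix (done + size j) js

  machineCost : Schedule n m → Fin m → ℚ
  machineCost S i = divPos (weightedPrefix 0ℚ (S i)) (speed i) (speed>0 i)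

  cost : Schedule n m → ℚ
  cost S = sumℚ (map (machineCost S) (allFin m))

  Optimal : Schedule n m → Set
  Optimal S = Valid S × (∀ S' → Valid S' → cost S ≤ cost S')

module Submission where

-- Let b be a speed-1 machine of OPT (its work is below 1)
-- and i any other machine, with load L, work W_i = L s_i and last job j.
-- Moving j to the end of b changes the total weighted completion time by
-- exactly  w_j (W_b + p_j) - w_j L , so optimality of OPT gives
--   L ≤ W_b + p_j ≤ W_b + W_i ≤ 1 + L s_i .
-- If s_i < 1, it is a power of 1+δ below 1, hence s_i (1+δ) ≤ 1, and the
-- inequality yields  L δ ≤ 1 + δ ≤ 2.  If s_i = 1 then L = W_i < 1 ≤ 2/δ.
-- As all speeds are at most 1, the work of a machine is at most its load.

open import Defs
open import Algebra.Bundles using (CommutativeMonoid)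
open import Data.Nat using (ℕ; zero; suc)
open import Data.Fin using (Fin; zero; suc; punchIn)
open import Data.Fin.Properties using (punchInᵢ≢i) renaming (_≟_ to _≟ᶠ_)
open import Data.Integer using (+_)
open import Data.List using (List; []; _∷_; _++_; [_]; foldr; map; concatMap; tabulate; allFin; initLast; _∷ʳ′_)
open import Data.List.Properties using (map-tabulate; ++-assoc; ++-identityʳ)
open import Data.List.Relation.Binary.Permutation.Propositional using (_↭_; ↭-trans; ↭-reflexive)
open import Data.List.Relation.Binary.Permutation.Propositional.Properties using (drop-mid; ++⁺ˡ; ++-comm; ++-commutativeMonoid)
open import Data.Product using (Σ; ∃₂; _×_; _,_)
open import Data.Rational using (ℚ; 0ℚ; 1ℚ; _+_; _*_; -_; _/_; 1/_; _≤_; _<_; Positive; NonNegative; nonNegative)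
open import Data.Rational.Properties
open import Data.Rational.Solver using (module +-*-Solver)
open import Data.Sum using (_⊎_; inj₁; inj₂)
open import Data.Unit using (tt)
open import Data.Vec.Functional using (Vector; removeAt; updateAt)
open import Data.Vec.Functional.Properties using (updateAt-updates; updateAt-minimal)
open import Function using (id; const; _∘_)
open import Relation.Nullary using (yes; no)
open import Relation.Nullary.Negation using (contradiction)
open import Relation.Binary.PropositionalEquality as ≡ using (_≡_; _≢_; refl; cong; cong₂; subst; subst₂)

open +-*-Solver

module FiniteSum {c ℓ} (M : CommutativeMonoid c ℓ) where
  open CommutativeMonoid M using (Carrier; _≈_; _∙_; ε; assoc; ∙-congʳ; sym; setoid; commutativeSemigroup)
  open import Algebra.Properties.CommutativeMonoid.Sum M using (sum-remove; sum-cong-≗)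
  open import Algebra.Properties.CommutativeMonoid.Sum M public using (sum)
  open import Algebra.Properties.CommutativeSemigroup commutativeSemigroup using (xy∙z≈zy∙x; xy∙z≈x∙zy)
  open import Relation.Binary.Reasoning.Setoid setoid

  foldr-allFin : ∀ {m} (f : Fin m → Carrier) → foldr _∙_ ε (map f (allFin m)) ≡ sum f
  foldr-allFin {m} f = ≡.trans (cong (foldr _∙_ ε) (map-tabulate id f)) (foldr-tabulate f)
    where
    foldr-tabulate : ∀ {k} (g : Fin k → Carrier) → foldr _∙_ ε (tabulate g) ≡ sum g
    foldr-tabulate {zero}  g = refl
    foldr-tabulate {suc k} g = cong (g zero ∙_) (foldr-tabulate (g ∘ suc))

  sum-exchange : ∀ {m} (g h : Vector Carrier m) (i : Fin m) →
    (∀ k → k ≢ i → g k ≡ h k) → sum g ∙ h i ≈ sum h ∙ g i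
  sum-exchange {suc m} g h i agree = begin
    sum g ∙ h i                       ≈⟨ ∙-congʳ (sum-remove {i = i} g) ⟩
    (g i ∙ sum (removeAt g i)) ∙ h i  ≡⟨ cong (λ r → (g i ∙ r) ∙ h i) (sum-cong-≗ rest) ⟩
    (g i ∙ sum (removeAt h i)) ∙ h i  ≈⟨ xy∙z≈zy∙x (g i) _ (h i) ⟩
    (h i ∙ sum (removeAt h i)) ∙ g i  ≈⟨ ∙-congʳ (sym (sum-remove {i = i} h)) ⟩
    sum h ∙ g i                       ∎
    where
    rest : ∀ k → removeAt g i k ≡ removeAt h i k
    rest k = agree (punchIn i k) (punchInᵢ≢i i k)

  sum-exchange₂ : ∀ {m} (g h : Vector Carrier m) (i b : Fin m) → i ≢ b →
    (∀ k → k ≢ i → k ≢ b → g k ≡ h k) → sum g ∙ (h i ∙ h b) ≈ sum h ∙ (g i ∙ g b)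
  sum-exchange₂ g h i b i≢b agree = begin
    sum g ∙ (h i ∙ h b)   ≈⟨ sym (assoc _ _ _) ⟩
    (sum g ∙ h i) ∙ h b   ≡⟨ cong (λ x → (sum g ∙ x) ∙ h b) (≡.sym (updateAt-minimal i b h i≢b)) ⟩
    (sum g ∙ t i) ∙ h b   ≈⟨ ∙-congʳ (sum-exchange g t i agree-i) ⟩
    (sum t ∙ g i) ∙ h b   ≈⟨ xy∙z≈x∙zy _ _ _ ⟩
    sum t ∙ (h b ∙ g i)   ≈⟨ sym (assoc _ _ _) ⟩
    (sum t ∙ h b) ∙ g i   ≈⟨ ∙-congʳ (sum-exchange t h b agree-b) ⟩
    (sum h ∙ t b) ∙ g i   ≡⟨ cong (λ x → (sum h ∙ x) ∙ g i) (updateAt-updates b h) ⟩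
    (sum h ∙ g b) ∙ g i   ≈⟨ xy∙z≈x∙zy _ _ _ ⟩
    sum h ∙ (g i ∙ g b)   ∎
    where
    t : Vector Carrier _
    t = updateAt h b (const (g b))
    agree-i : ∀ k → k ≢ i → g k ≡ t k
    agree-i k k≢i with k ≟ᶠ b
    ... | yes refl = ≡.sym (updateAt-updates b h)
    ... | no k≢b = ≡.trans (agree k k≢i k≢b) (≡.sym (updateAt-minimal k b h k≢b))
    agree-b : ∀ k → k ≢ b → t k ≡ h k
    agree-b k k≢b = updateAt-minimal k b h k≢b

++-cancelʳ-↭ : ∀ {A : Set} {xs ys : List A} zs → xs ++ zs ↭ ys ++ zs → xs ↭ ys
++-cancelʳ-↭ {xs = xs} {ys} []       p = subst₂ _↭_ (++-identityʳ xs) (++-identityʳ ys) p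
++-cancelʳ-↭ {xs = xs} {ys} (z ∷ zs) p = ++-cancelʳ-↭ zs (drop-mid xs ys p)

empty-or-snoc : ∀ {A : Set} (l : List A) → l ≡ [] ⊎ ∃₂ λ xs j → l ≡ xs ++ [ j ]
empty-or-snoc l with initLast l
... | []       = inj₁ refl
... | xs ∷ʳ′ j = inj₂ (xs , j , refl)

sumℚ-foldr : ∀ l → sumℚ l ≡ foldr _+_ 0ℚ l
sumℚ-foldr []      = refl
sumℚ-foldr (x ∷ l) = cong (_+_ x) (sumℚ-foldr l)

+-cancelʳ-≤ : ∀ r {p q} → p + r ≤ q + r → p ≤ q
+-cancelʳ-≤ r {p} {q} h = subst₂ _≤_ (cancel p) (cancel q) (+-monoˡ-≤ (- r) h)
  where
  cancel : ∀ x → x + r + - r ≡ x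
  cancel x = solve 2 (λ x r → x :+ r :+ (:- r) := x) refl x r

≤-divPos : ∀ {x c} δ (δ>0 : Positive δ) → x * δ ≤ c → x ≤ divPos c δ δ>0
≤-divPos {x} {c} δ δ>0 xδ≤c = *-cancelʳ-≤-pos δ {{δ>0}} (subst (x * δ ≤_) (≡.sym c/δ*δ≡c) xδ≤c)
  where
  instance _ = pos⇒nonZero δ {{δ>0}}
  c/δ*δ≡c : divPos c δ δ>0 * δ ≡ c
  c/δ*δ≡c = ≡.trans (*-assoc c (1/ δ) δ) (≡.trans (cong (c *_) (*-inverseˡ δ)) (*-identityʳ c))

1≤2/δ : ∀ δ (δ>0 : Positive δ) → δ ≤ 1ℚ → 1ℚ ≤ divPos (+ 2 / 1) δ δ>0
1≤2/δ δ δ>0 δ≤1 = ≤-divPos {c = + 2 / 1} δ δ>0 (≤-trans (≤-reflexive (*-identityˡ δ)) (≤-trans δ≤1 (≤ᵇ⇒≤ tt)))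

divPos-one : ∀ x s (s>0 : Positive s) → s ≡ 1ℚ → divPos x s s>0 ≡ x
divPos-one x _ _ refl = *-identityʳ x

1≤^ℕ : ∀ {b} → 1ℚ ≤ b → ∀ k → 1ℚ ≤ b ^ℕ k
1≤^ℕ 1≤b zero    = ≤-refl
1≤^ℕ {b} 1≤b (suc k) = ≤-trans 1≤b (subst (_≤ b * (b ^ℕ k)) (*-identityʳ b)
  (*-monoˡ-≤-nonNeg b {{nonNegative (≤-trans (≤ᵇ⇒≤ tt) 1≤b)}} (1≤^ℕ 1≤b k)))

-- Integer powers of b > 1 are spaced by factors of b: a power s < 1 is at
-- most 1/b.  This is where speeds being powers of 1+δ is used.
power-below-one : ∀ {b s} → 1ℚ < b → 0ℚ ≤ s → IsIntegerPowerOf b s → s ≤ 1ℚ → s ≢ 1ℚ → s * b ≤ 1ℚ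
power-below-one 1<b 0≤s (inj₁ (zero , s≡1)) s≤1 s≢1 = contradiction s≡1 s≢1
power-below-one {b} {s} 1<b 0≤s (inj₁ (suc k , s≡b^k)) s≤1 s≢1 =
  contradiction (<-≤-trans (<-≤-trans 1<b b≤s) s≤1) (<-irrefl refl)
  where
  b≤s : b ≤ s
  b≤s = subst₂ _≤_ (*-identityʳ b) (≡.sym s≡b^k)
    (*-monoˡ-≤-nonNeg b {{nonNegative (≤-trans (≤ᵇ⇒≤ tt) (<⇒≤ 1<b))}} (1≤^ℕ (<⇒≤ 1<b) k))
power-below-one {s = s} 1<b 0≤s (inj₂ (zero , s*1≡1)) s≤1 s≢1 =
  contradiction (≡.trans (≡.sym (*-identityʳ s)) s*1≡1) s≢1
power-below-one {b} {s} 1<b 0≤s (inj₂ (suc k , s*b^k≡1)) s≤1 s≢1 = begin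
  s * b                ≡⟨ *-identityʳ (s * b) ⟨
  s * b * 1ℚ           ≤⟨ *-monoˡ-≤-nonNeg (s * b) {{nonNegative 0≤sb}} (1≤^ℕ (<⇒≤ 1<b) k) ⟩
  s * b * (b ^ℕ k)     ≡⟨ ≡.trans (*-assoc s b (b ^ℕ k)) s*b^k≡1 ⟩
  1ℚ                   ∎
  where
  open ≤-Reasoning
  0≤sb : 0ℚ ≤ s * b
  0≤sb = subst (_≤ s * b) (*-zeroʳ s) (*-monoˡ-≤-nonNeg s {{nonNegative 0≤s}} (≤-trans (≤ᵇ⇒≤ tt) (<⇒≤ 1<b)))

slow-load-bound : ∀ δ (δ>0 : Positive δ) → δ ≤ 1ℚ → ∀ {L s} → 0ℚ ≤ L →
  s * (1ℚ + δ) ≤ 1ℚ → L ≤ 1ℚ + L * s → L ≤ divPos (+ 2 / 1) δ δ>0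
slow-load-bound δ δ>0 δ≤1 {L} {s} 0≤L s[1+δ]≤1 L≤1+Ls = ≤-divPos δ δ>0 (begin
  L * δ     ≤⟨ +-cancelʳ-≤ L Lδ+L≤1+δ+L ⟩
  1ℚ + δ    ≤⟨ +-monoʳ-≤ 1ℚ δ≤1 ⟩
  1ℚ + 1ℚ   ≤⟨ ≤ᵇ⇒≤ tt ⟩
  + 2 / 1   ∎)
  where
  open ≤-Reasoning
  0≤1+δ : 0ℚ ≤ 1ℚ + δ
  0≤1+δ = ≤-trans (≤ᵇ⇒≤ tt) (+-monoʳ-≤ 1ℚ (<⇒≤ (positive⁻¹ δ {{δ>0}})))
  Lδ+L≤1+δ+L : L * δ + L ≤ (1ℚ + δ) + L
  Lδ+L≤1+δ+L = begin
    L * δ + L                      ≡⟨ solve 2 (λ L δ → L :* δ :+ L := L :* (con 1ℚ :+ δ)) refl L δ ⟩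
    L * (1ℚ + δ)                   ≤⟨ *-monoʳ-≤-nonNeg (1ℚ + δ) {{nonNegative 0≤1+δ}} L≤1+Ls ⟩
    (1ℚ + L * s) * (1ℚ + δ)        ≡⟨ solve 3 (λ L s δ → (con 1ℚ :+ L :* s) :* (con 1ℚ :+ δ) := (con 1ℚ :+ δ) :+ L :* (s :* (con 1ℚ :+ δ))) refl L s δ ⟩
    (1ℚ + δ) + L * (s * (1ℚ + δ))  ≤⟨ +-monoʳ-≤ (1ℚ + δ) (*-monoˡ-≤-nonNeg L {{nonNegative 0≤L}} s[1+δ]≤1) ⟩
    (1ℚ + δ) + L * 1ℚ              ≡⟨ cong (λ x → (1ℚ + δ) + x) (*-identityʳ L) ⟩
    (1ℚ + δ) + L                   ∎

module Scheduling {n m : ℕ} (I : Instance n m) where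
  open Instance I

  module CostSum = FiniteSum +-0-commutativeMonoid
  module JobSum = FiniteSum (++-commutativeMonoid {A = Fin n})

  inverseSpeed : Fin m → ℚ
  inverseSpeed k = (1/ speed k) {{pos⇒nonZero (speed k) {{speed>0 k}}}}

  inverseSpeed-nonNeg : ∀ k → NonNegative (inverseSpeed k)
  inverseSpeed-nonNeg k = pos⇒nonNeg (inverseSpeed k) {{1/pos⇒pos (speed k) {{speed>0 k}}}}

  workOf : List (Fin n) → ℚ
  workOf l = sumℚ (map size l)

  loadOn : Fin m → List (Fin n) → ℚ
  loadOn k l = workOf l * inverseSpeed k

  costOn : Fin m → List (Fin n) → ℚ
  costOn k l = weightedPrefix I 0ℚ l * inverseSpeed k

  workOf-nonNeg : ∀ l → 0ℚ ≤ workOf l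
  workOf-nonNeg []      = ≤-refl
  workOf-nonNeg (x ∷ l) = +-mono-≤ (<⇒≤ (positive⁻¹ (size x) {{size>0 x}})) (workOf-nonNeg l)

  workOf-snoc : ∀ l j → workOf (l ++ [ j ]) ≡ workOf l + size j
  workOf-snoc []      j = ≡.trans (+-identityʳ (size j)) (≡.sym (+-identityˡ (size j)))
  workOf-snoc (x ∷ l) j = ≡.trans (cong (_+_ (size x)) (workOf-snoc l j)) (≡.sym (+-assoc (size x) _ _))

  weightedPrefix-snoc : ∀ d l j →
    weightedPrefix I d (l ++ [ j ]) ≡ weightedPrefix I d l + weight j * (d + workOf (l ++ [ j ]))
  weightedPrefix-snoc d [] j =
    solve 3 (λ w d p → w :* (d :+ p) :+ con 0ℚ := con 0ℚ :+ w :* (d :+ (p :+ con 0ℚ))) refl (weight j) d (size j)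
  weightedPrefix-snoc d (x ∷ l) j = ≡.trans
    (cong (_+_ (weight x * (d + size x))) (weightedPrefix-snoc (d + size x) l j))
    (solve 6 (λ wx d px A wj W → wx :* (d :+ px) :+ (A :+ wj :* ((d :+ px) :+ W))
                                := (wx :* (d :+ px) :+ A) :+ wj :* (d :+ (px :+ W)))
       refl (weight x) d (size x) (weightedPrefix I (d + size x) l) (weight j) (workOf (l ++ [ j ])))

  costOn-snoc : ∀ k l j → costOn k (l ++ [ j ]) ≡ costOn k l + weight j * loadOn k (l ++ [ j ])
  costOn-snoc k l j = ≡.trans (cong (_* inverseSpeed k) (weightedPrefix-snoc 0ℚ l j))
    (solve 4 (λ A w W r → (A :+ w :* (con 0ℚ :+ W)) :* r := A :* r :+ w :* (W :* r))
       refl (weightedPrefix I 0ℚ l) (weight j) (workOf (l ++ [ j ])) (inverseSpeed k))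

  load-nonNeg : ∀ S k → 0ℚ ≤ load I S k
  load-nonNeg S k = subst (_≤ load I S k) (*-zeroˡ (inverseSpeed k))
    (*-monoʳ-≤-nonNeg (inverseSpeed k) {{inverseSpeed-nonNeg k}} (workOf-nonNeg (S k)))

  work≡load*speed : ∀ S k → work I S k ≡ load I S k * speed k
  work≡load*speed S k = ≡.sym (begin
    work I S k * inverseSpeed k * speed k    ≡⟨ *-assoc (work I S k) (inverseSpeed k) (speed k) ⟩
    work I S k * (inverseSpeed k * speed k)  ≡⟨ cong (work I S k *_) (*-inverseˡ (speed k) {{pos⇒nonZero (speed k) {{speed>0 k}}}}) ⟩
    work I S k * 1ℚ                          ≡⟨ *-identityʳ (work I S k) ⟩
    work I S k                               ∎)
    where open ≡.≡-Reasoning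

  work≤load : ∀ S k → speed k ≤ 1ℚ → work I S k ≤ load I S k
  work≤load S k sk≤1 = begin
    work I S k             ≡⟨ work≡load*speed S k ⟩
    load I S k * speed k   ≤⟨ *-monoˡ-≤-nonNeg (load I S k) {{nonNegative (load-nonNeg S k)}} sk≤1 ⟩
    load I S k * 1ℚ        ≡⟨ *-identityʳ (load I S k) ⟩
    load I S k             ∎
    where open ≤-Reasoning

  cost-as-sum : ∀ S → cost I S ≡ CostSum.sum (machineCost I S)
  cost-as-sum S = ≡.trans (sumℚ-foldr (map (machineCost I S) (allFin m))) (CostSum.foldr-allFin (machineCost I S))

  jobs-as-sum : ∀ (S : Schedule n m) → concatMap S (allFin m) ≡ JobSum.sum S
  jobs-as-sum S = JobSum.foldr-allFin S

  moveLast : Schedule n m → (i b : Fin m) → List (Fin n) → Fin n → Schedule n m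
  moveLast S i b xs j = updateAt (updateAt S b (_++ [ j ])) i (const xs)

  moveLast-at-i : ∀ S {i b} xs j → moveLast S i b xs j i ≡ xs
  moveLast-at-i S {i} {b} xs j = updateAt-updates i (updateAt S b (_++ [ j ]))

  moveLast-at-b : ∀ S {i b} xs j → i ≢ b → moveLast S i b xs j b ≡ S b ++ [ j ]
  moveLast-at-b S {i} {b} xs j i≢b = ≡.trans
    (updateAt-minimal b i (updateAt S b (_++ [ j ])) (i≢b ∘ ≡.sym)) (updateAt-updates b S)

  moveLast-elsewhere : ∀ S {i b} xs j k → k ≢ i → k ≢ b → moveLast S i b xs j k ≡ S k
  moveLast-elsewhere S {i} {b} xs j k k≢i k≢b = ≡.trans
    (updateAt-minimal k i (updateAt S b (_++ [ j ])) k≢i) (updateAt-minimal k b S k≢b)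

  moveLast-valid : ∀ S {i b xs j} → i ≢ b → S i ≡ xs ++ [ j ] → Valid S → Valid (moveLast S i b xs j)
  moveLast-valid S {i} {b} {xs} {j} i≢b Si≡xs+j valid = ↭-trans moved≈jobs valid
    where
    S′ = moveLast S i b xs j
    two-machines : S′ i ++ S′ b ↭ S i ++ S b
    two-machines rewrite moveLast-at-i S {i} {b} xs j | moveLast-at-b S xs j i≢b | Si≡xs+j =
      ↭-trans (++⁺ˡ xs (++-comm (S b) [ j ])) (↭-reflexive (≡.sym (++-assoc xs [ j ] (S b))))
    exchanged : JobSum.sum S′ ++ (S i ++ S b) ↭ JobSum.sum S ++ (S i ++ S b)
    exchanged = ↭-trans (JobSum.sum-exchange₂ S′ S i b i≢b (moveLast-elsewhere S xs j))
                        (++⁺ˡ (JobSum.sum S) two-machines)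
    moved≈jobs : concatMap S′ (allFin m) ↭ concatMap S (allFin m)
    moved≈jobs = subst₂ _↭_ (≡.sym (jobs-as-sum S′)) (≡.sym (jobs-as-sum S))
                   (++-cancelʳ-↭ (S i ++ S b) exchanged)

  moveLast-cost : ∀ S {i b xs j} → i ≢ b → S i ≡ xs ++ [ j ] →
    cost I (moveLast S i b xs j) + (costOn i (xs ++ [ j ]) + costOn b (S b))
      ≡ cost I S + (costOn i xs + costOn b (S b ++ [ j ]))
  moveLast-cost S {i} {b} {xs} {j} i≢b Si≡xs+j = begin
    cost I S′ + (costOn i (xs ++ [ j ]) + costOn b (S b))
      ≡⟨ cong₂ (λ C c → C + (c + costOn b (S b))) (cost-as-sum S′) (cong (costOn i) (≡.sym Si≡xs+j)) ⟩
    CostSum.sum (machineCost I S′) + (machineCost I S i + machineCost I S b)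
      ≡⟨ CostSum.sum-exchange₂ (machineCost I S′) (machineCost I S) i b i≢b
           (λ k k≢i k≢b → cong (costOn k) (moveLast-elsewhere S xs j k k≢i k≢b)) ⟩
    CostSum.sum (machineCost I S) + (machineCost I S′ i + machineCost I S′ b)
      ≡⟨ cong₂ _+_ (≡.sym (cost-as-sum S))
           (cong₂ _+_ (cong (costOn i) (moveLast-at-i S xs j)) (cong (costOn b) (moveLast-at-b S xs j i≢b))) ⟩
    cost I S + (costOn i xs + costOn b (S b ++ [ j ]))  ∎
    where
    open ≡.≡-Reasoning
    S′ = moveLast S i b xs j

  last-job-bound : ∀ S {i b xs j} → Optimal I S → i ≢ b → S i ≡ xs ++ [ j ] →
    loadOn i (xs ++ [ j ]) ≤ loadOn b (S b ++ [ j ])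
  last-job-bound S {i} {b} {xs} {j} (valid , optimal) i≢b Si≡xs+j =
    *-cancelˡ-≤-pos w {{weight>0 j}} (+-cancelʳ-≤ (cost I S + X) (begin
      w * Lᵢ + (cost I S + X)
        ≤⟨ +-monoʳ-≤ (w * Lᵢ) (+-monoˡ-≤ X (optimal S′ (moveLast-valid S i≢b Si≡xs+j valid))) ⟩
      w * Lᵢ + (cost I S′ + X)
        ≡⟨ regroup (w * Lᵢ) (cost I S′) (costOn i xs) (costOn b (S b)) ⟩
      cost I S′ + ((costOn i xs + w * Lᵢ) + costOn b (S b))
        ≡⟨ cong (λ c → cost I S′ + (c + costOn b (S b))) (≡.sym (costOn-snoc i xs j)) ⟩
      cost I S′ + (costOn i (xs ++ [ j ]) + costOn b (S b))
        ≡⟨ moveLast-cost S i≢b Si≡xs+j ⟩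
      cost I S + (costOn i xs + costOn b (S b ++ [ j ]))
        ≡⟨ cong (λ c → cost I S + (costOn i xs + c)) (costOn-snoc b (S b) j) ⟩
      cost I S + (costOn i xs + (costOn b (S b) + w * L′))
        ≡⟨ ≡.sym (regroup′ (w * L′) (cost I S) (costOn i xs) (costOn b (S b))) ⟩
      w * L′ + (cost I S + X)  ∎))
    where
    open ≤-Reasoning
    w  = weight j
    Lᵢ = loadOn i (xs ++ [ j ])
    L′ = loadOn b (S b ++ [ j ])
    X  = costOn i xs + costOn b (S b)
    S′ = moveLast S i b xs j
    regroup : ∀ d C x y → d + (C + (x + y)) ≡ C + ((x + d) + y)
    regroup = solve 4 (λ d C x y → d :+ (C :+ (x :+ y)) := C :+ ((x :+ d) :+ y)) refl
    regroup′ : ∀ d C x y → d + (C + (x + y)) ≡ C + (x + (y + d))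
    regroup′ = solve 4 (λ d C x y → d :+ (C :+ (x :+ y)) := C :+ (x :+ (y :+ d))) refl

  transfer-bound : ∀ S {i b} → Optimal I S → i ≢ b →
    load I S i ≤ (work I S b + work I S i) * inverseSpeed b
  transfer-bound S {i} {b} opt i≢b with empty-or-snoc (S i)
  ... | inj₁ Si≡[] = begin
    load I S i                                   ≡⟨ cong (loadOn i) Si≡[] ⟩
    0ℚ * inverseSpeed i                          ≡⟨ *-zeroˡ (inverseSpeed i) ⟩
    0ℚ                                           ≡⟨ *-zeroˡ (inverseSpeed b) ⟨
    0ℚ * inverseSpeed b                          ≤⟨ *-monoʳ-≤-nonNeg (inverseSpeed b) {{inverseSpeed-nonNeg b}} 0≤Wb+Wi ⟩
    (work I S b + work I S i) * inverseSpeed b   ∎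
    where
    open ≤-Reasoning
    0≤Wb+Wi : 0ℚ ≤ work I S b + work I S i
    0≤Wb+Wi = +-mono-≤ (workOf-nonNeg (S b)) (workOf-nonNeg (S i))
  ... | inj₂ (xs , j , Si≡xs+j) = begin
    load I S i                                   ≡⟨ cong (loadOn i) Si≡xs+j ⟩
    loadOn i (xs ++ [ j ])                       ≤⟨ last-job-bound S opt i≢b Si≡xs+j ⟩
    workOf (S b ++ [ j ]) * inverseSpeed b       ≡⟨ cong (_* inverseSpeed b) (workOf-snoc (S b) j) ⟩
    (work I S b + size j) * inverseSpeed b       ≤⟨ *-monoʳ-≤-nonNeg (inverseSpeed b) {{inverseSpeed-nonNeg b}} (+-monoʳ-≤ (work I S b) pⱼ≤Wᵢ) ⟩
    (work I S b + work I S i) * inverseSpeed b   ∎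
    where
    open ≤-Reasoning
    pⱼ≤Wᵢ : size j ≤ work I S i
    pⱼ≤Wᵢ = begin
      size j                  ≡⟨ +-identityˡ (size j) ⟨
      0ℚ + size j             ≤⟨ +-monoˡ-≤ (size j) (workOf-nonNeg xs) ⟩
      workOf xs + size j      ≡⟨ workOf-snoc xs j ⟨
      workOf (xs ++ [ j ])    ≡⟨ cong workOf Si≡xs+j ⟨
      work I S i              ∎

mainTheorem9 : (δ : ℚ) → (δ>0 : Positive δ) → δ ≤ (+ 1 / 8) →
    {n m : ℕ} → (I : Instance n m) →
    (∀ i → IsIntegerPowerOf (1ℚ + δ) (Instance.speed I i)) →
    (∀ i → Instance.speed I i ≤ 1ℚ) →
    Σ (Fin m) (λ i → Instance.speed I i ≡ 1ℚ) →
    (OPT : Schedule n m) → Optimal I OPT →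
    Σ (Fin m) (λ i → Instance.speed I i ≡ 1ℚ ×
      divPos 1ℚ (1ℚ + δ) (1+pos δ δ>0) ≤ work I OPT i) →
    (∀ i → Instance.speed I i ≡ 1ℚ → work I OPT i < 1ℚ) →
    ∀ i → load I OPT i ≤ divPos (+ 2 / 1) δ δ>0 × work I OPT i ≤ divPos (+ 2 / 1) δ δ>0
mainTheorem9 δ δ>0 δ≤⅛ I powers speed≤1 _ OPT opt (b , sb≡1 , _) fast-work<1 i =
  load≤2/δ , ≤-trans (work≤load OPT i (speed≤1 i)) load≤2/δ
  where
  open Instance I
  open Scheduling I
  open ≤-Reasoning
  δ≤1 : δ ≤ 1ℚ
  δ≤1 = ≤-trans δ≤⅛ (≤ᵇ⇒≤ tt)
  load≤2/δ : load I OPT i ≤ divPos (+ 2 / 1) δ δ>0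
  load≤2/δ with speed i ≟ 1ℚ
  ... | yes sᵢ≡1 = begin
    load I OPT i   ≡⟨ divPos-one (work I OPT i) (speed i) (speed>0 i) sᵢ≡1 ⟩
    work I OPT i   ≤⟨ <⇒≤ (fast-work<1 i sᵢ≡1) ⟩
    1ℚ             ≤⟨ 1≤2/δ δ δ>0 δ≤1 ⟩
    divPos (+ 2 / 1) δ δ>0  ∎
  ... | no sᵢ≢1 = slow-load-bound δ δ>0 δ≤1 (load-nonNeg OPT i) sᵢ[1+δ]≤1 (begin
    load I OPT i                                 ≤⟨ transfer-bound OPT opt i≢b ⟩
    (work I OPT b + work I OPT i) * inverseSpeed b ≡⟨ divPos-one _ (speed b) (speed>0 b) sb≡1 ⟩
    work I OPT b + work I OPT i                  ≤⟨ +-monoˡ-≤ (work I OPT i) (<⇒≤ (fast-work<1 b sb≡1)) ⟩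
    1ℚ + work I OPT i                            ≡⟨ cong (_+_ 1ℚ) (work≡load*speed OPT i) ⟩
    1ℚ + load I OPT i * speed i                  ∎)
    where
    i≢b : i ≢ b
    i≢b i≡b = sᵢ≢1 (≡.trans (cong speed i≡b) sb≡1)
    1<1+δ : 1ℚ < 1ℚ + δ
    1<1+δ = subst (_< 1ℚ + δ) (+-identityʳ 1ℚ) (+-monoʳ-< 1ℚ (positive⁻¹ δ {{δ>0}}))
    sᵢ[1+δ]≤1 : speed i * (1ℚ + δ) ≤ 1ℚ
    sᵢ[1+δ]≤1 = power-below-one 1<1+δ (<⇒≤ (positive⁻¹ (speed i) {{speed>0 i}})) (powers i) (speed≤1 i) sᵢ≢1
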